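{- Let $G=(V,E)$ be a connected VC-irreducible graph and let $x,y$ be two adjacent vertices of $G$, each of degree $2$. Let $u$ be the neighbor of $x$ other than $y$ and $v$ the neighbor of $y$ other than $x$. Then the graph $H=(V\setminus\{x,y\},\ \{\{u,v\}\}\cup (E\setminus\{e\in E: e\cap\{x,y\}\neq\emptyset\}))$ is VC-irreducible, and the minimum vertex cover size of $H$ is one less than that of $G$.
   Context: A vertex cover is a set of vertices meeting every edge. A connected graph $G=(V,E)$ is VC-irreducible if for every edge $e\in E$ the graph $(V,E\setminus\{e\})$ has strictly smaller minimum vertex cover size than $G$. -}

module Defs where

open import Data.Nat using (ℕ; zero; suc; _<_; _≤_; _+_)
open import Data.Fin using (Fin; _≟_)
open import Data.Fin.Subset using (Subset; _∈_; ∣_∣)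
open import Data.Bool using (Bool; true; false; _∧_; _∨_; not; if_then_else_)
open import Data.List using (List; map; allFin)
open import Data.Nat.ListAction using (sum)
open import Data.Product using (Σ; _×_; ∃; _,_)
open import Data.Sum using (_⊎_)
open import Relation.Nullary using (¬_)
open import Relation.Nullary.Decidable using (⌊_⌋)
open import Relation.Binary.PropositionalEquality using (_≡_)

-- A (finite) graph on a subset of the ground set Fin n:
-- `vert i` says whether i is a vertex, `adj i j` whether {i,j} is an edge.
-- (Loops {i,i} are representable; they are needed because the reduced
-- graph H may contain the edge {u,v} with u = v.)
record Graph (n : ℕ) : Set where
  constructor mkGraph
  field
    vert : Fin n → Bool
    adj  : Fin n → Fin n → Bool
open Graph public

record Simple {n : ℕ} (G : Graph n) : Set where
  field
    symm    : ∀ i j → adj G i j ≡ adj G j i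
    loopless : ∀ i → adj G i i ≡ false
    closed  : ∀ i j → adj G i j ≡ true → vert G i ≡ true

_==_ : ∀ {n} → Fin n → Fin n → Bool
i == j = ⌊ i ≟ j ⌋

sameEdge : ∀ {n} → Fin n → Fin n → Fin n → Fin n → Bool
sameEdge i j a b = (i == a ∧ j == b) ∨ (i == b ∧ j == a)

removeEdge : ∀ {n} → Graph n → Fin n → Fin n → Graph n
removeEdge G a b = mkGraph (vert G) (λ i j → adj G i j ∧ not (sameEdge i j a b))

degree : ∀ {n} → Graph n → Fin n → ℕ
degree {n} G x = sum (map (λ w → if adj G x w then 1 else 0) (allFin n))

data Walk {n : ℕ} (G : Graph n) : Fin n → Fin n → Set where
  here : ∀ {a} → Walk G a a
  step : ∀ {a c b} → adj G a c ≡ true → Walk G c b → Walk G a b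

Connected : ∀ {n} → Graph n → Set
Connected G = ∀ a b → vert G a ≡ true → vert G b ≡ true → Walk G a b

VertexCover : ∀ {n} → Graph n → Subset n → Set
VertexCover G S =
  (∀ i → i ∈ S → vert G i ≡ true) ×
  (∀ i j → adj G i j ≡ true → i ∈ S ⊎ j ∈ S)

IsMinVCSize : ∀ {n} → Graph n → ℕ → Set
IsMinVCSize G k =
  (Σ (Subset _) λ S → VertexCover G S × ∣ S ∣ ≡ k) ×
  (∀ S → VertexCover G S → k ≤ ∣ S ∣)

VCIrreducible : ∀ {n} → Graph n → Set
VCIrreducible G =
  Connected G ×
  (∀ a b → adj G a b ≡ true →
    ∀ k k' → IsMinVCSize G k → IsMinVCSize (removeEdge G a b) k' → k' < k)

reduce : ∀ {n} → Graph n → (x y u v : Fin n) → Graph n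
reduce G x y u v = mkGraph
  (λ i → vert G i ∧ not (i == x ∨ i == y))
  (λ i j → (adj G i j ∧ not (i == x ∨ i == y ∨ j == x ∨ j == y)) ∨ sameEdge i j u v)

-- As x and y have degree 2, a vertex cover of G contains x or y and covers the edges xu and yv.
-- Deleting x and y from a cover C of G, and adding u when both lay in C, leaves a cover of H of
-- size at most |C| - 1; conversely, a cover D of H contains u or v, and adding y or x respectively
-- gives a cover of G of size |D| + 1.  Hence τ(G) = τ(H) + 1.  The same transfer from G - e to
-- H - ab, with e = xu when ab is the new edge uv and e = ab otherwise, shows that deleting any
-- edge of H lowers τ.  Replacing x by u and y by v maps walks of G to walks of H.

module Submission where

open import Defs
open import Data.Nat using (ℕ; zero; suc; _≤_; _<_; s≤s; z≤n)
open import Data.Nat.Properties using (≤-refl; ≤-trans; ≤-pred; ≤-antisym; ≤-<-trans; <-≤-trans; ≮⇒≥; _<?_)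
open import Data.Fin using (Fin; zero; suc; _≟_)
open import Data.Fin.Properties using (all?)
open import Data.Fin.Subset using (Subset; _∈_; _∉_; ∣_∣; ⁅_⁆; _∪_; _─_; _-_; inside; outside)
open import Data.Fin.Subset.Properties
  using (_∈?_; anySubset?; x∈⁅x⁆; x∈⁅y⁆⇒x≡y; x∈p∪q⁺; x∈p∪q⁻; ∪-identityˡ; ∣p∣≤∣x∷p∣;
         ∣p─q∣≤∣p∣; p─q⊆p; x∈p∧x≢y⇒x∈p-y; x∈p⇒∣p-x∣<∣p∣)
open import Data.Bool using (Bool; true; false; _∧_; _∨_; not; if_then_else_) renaming (_≟_ to _≟ᵇ_)
open import Data.Bool.Properties using (∧-conicalˡ; ∧-conicalʳ; ∨-zeroʳ)
import Data.List as List
open import Data.List.Properties using (map-tabulate)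
open import Data.Nat.ListAction using (sum)
import Data.Vec as Vec
open import Data.Vec using (_∷_; there)
open import Data.Vec.Properties using ([]=⇒lookup; lookup⇒[]=; lookup∘tabulate)
open import Data.Product using (Σ; _×_; _,_; proj₁; proj₂)
open import Data.Sum using (_⊎_; inj₁; inj₂; swap)
import Data.Sum as Sum
open import Function using (_∘_; id)
open import Relation.Nullary using (¬_; Dec; yes; no; contradiction)
open import Relation.Nullary.Decidable using (_×-dec_; _⊎-dec_; _→-dec_)
open import Relation.Binary.PropositionalEquality using (_≡_; _≢_; refl; sym; trans; cong; subst; subst₂)

private variable
  n : ℕ

==⇒≡ : {i j : Fin n} → i == j ≡ true → i ≡ j
==⇒≡ {i = i} {j} e with i ≟ j
... | yes i≡j = i≡j

≡⇒== : {i j : Fin n} → i ≡ j → i == j ≡ true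
≡⇒== {i = i} {j} i≡j with i ≟ j
... | yes _  = refl
... | no i≢j = contradiction i≡j i≢j

≢⇒== : {i j : Fin n} → i ≢ j → i == j ≡ false
≢⇒== {i = i} {j} i≢j with i ≟ j
... | yes i≡j = contradiction i≡j i≢j
... | no _    = refl

not-==⇒≢ : {i j : Fin n} → not (i == j) ≡ true → i ≢ j
not-==⇒≢ {i = i} {j} e with i ≟ j
... | no i≢j = i≢j

∨-true : ∀ a b → a ∨ b ≡ true → a ≡ true ⊎ b ≡ true
∨-true true  _ _ = inj₁ refl
∨-true false _ e = inj₂ e

not-∨ : ∀ a b → not (a ∨ b) ≡ true → not a ≡ true × not b ≡ true
not-∨ false false _ = refl , refl

⊎-resolveˡ : {A B : Set} → ¬ A → A ⊎ B → B
⊎-resolveˡ ¬a (inj₁ a) = contradiction a ¬a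
⊎-resolveˡ _  (inj₂ b) = b

x∈p─q⇒x∉q : {x : Fin n} {p q : Subset n} → x ∈ p ─ q → x ∉ q
x∈p─q⇒x∉q {x = zero}  {_ ∷ p} {outside ∷ q} _ ()
x∈p─q⇒x∉q {x = suc x} {_ ∷ p} {_ ∷ q} (there x∈p─q) (there x∈q) = x∈p─q⇒x∉q x∈p─q x∈q

x∈p-y⇒x∈p×x≢y : {x y : Fin n} {p : Subset n} → x ∈ p - y → x ∈ p × x ≢ y
x∈p-y⇒x∈p×x≢y {y = y} {p} x∈p-y =
  p─q⊆p p ⁅ y ⁆ x∈p-y , λ { refl → x∈p─q⇒x∉q x∈p-y (x∈⁅x⁆ y) }

∣⁅x⁆∪p∣≤1+∣p∣ : ∀ (x : Fin n) p → ∣ ⁅ x ⁆ ∪ p ∣ ≤ suc ∣ p ∣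
∣⁅x⁆∪p∣≤1+∣p∣ zero    (s ∷ p) rewrite ∪-identityˡ p = s≤s (∣p∣≤∣x∷p∣ s p)
∣⁅x⁆∪p∣≤1+∣p∣ (suc x) (outside ∷ p) = ∣⁅x⁆∪p∣≤1+∣p∣ x p
∣⁅x⁆∪p∣≤1+∣p∣ (suc x) (inside ∷ p)  = s≤s (∣⁅x⁆∪p∣≤1+∣p∣ x p)

∣p-x-y∣<∣p∣ : {x y : Fin n} (p : Subset n) → y ≢ x → x ∈ p ⊎ y ∈ p → ∣ p - x - y ∣ < ∣ p ∣
∣p-x-y∣<∣p∣ {x = x} {y} p y≢x (inj₁ x∈p) = ≤-<-trans (∣p─q∣≤∣p∣ (p - x) ⁅ y ⁆) (x∈p⇒∣p-x∣<∣p∣ x∈p)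
∣p-x-y∣<∣p∣ {x = x} {y} p y≢x (inj₂ y∈p) =
  <-≤-trans (x∈p⇒∣p-x∣<∣p∣ (x∈p∧x≢y⇒x∈p-y y∈p y≢x)) (∣p─q∣≤∣p∣ p ⁅ x ⁆)

∈-tabulate⁺ : {f : Fin n → Bool} {i : Fin n} → f i ≡ true → i ∈ Vec.tabulate f
∈-tabulate⁺ {f = f} {i} fi = lookup⇒[]= i (Vec.tabulate f) (trans (lookup∘tabulate f i) fi)

∈-tabulate⁻ : {f : Fin n → Bool} {i : Fin n} → i ∈ Vec.tabulate f → f i ≡ true
∈-tabulate⁻ {f = f} {i} i∈ = trans (sym (lookup∘tabulate f i)) ([]=⇒lookup i∈)

3≤∣p∣ : {a b c : Fin n} {p : Subset n} → a ∈ p → b ∈ p → c ∈ p →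
        a ≢ b → a ≢ c → b ≢ c → 3 ≤ ∣ p ∣
3≤∣p∣ {a = a} {b} {c} {p} a∈p b∈p c∈p a≢b a≢c b≢c =
  ≤-trans (s≤s (≤-trans (s≤s 1≤∣p-a-b∣) ∣p-a-b∣<∣p-a∣)) ∣p-a∣<∣p∣
  where
  c∈p-a-b : c ∈ p - a - b
  c∈p-a-b = x∈p∧x≢y⇒x∈p-y (x∈p∧x≢y⇒x∈p-y c∈p (a≢c ∘ sym)) (b≢c ∘ sym)
  1≤∣p-a-b∣ : 1 ≤ ∣ p - a - b ∣
  1≤∣p-a-b∣ = ≤-<-trans z≤n (x∈p⇒∣p-x∣<∣p∣ c∈p-a-b)
  ∣p-a-b∣<∣p-a∣ : ∣ p - a - b ∣ < ∣ p - a ∣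
  ∣p-a-b∣<∣p-a∣ = x∈p⇒∣p-x∣<∣p∣ (x∈p∧x≢y⇒x∈p-y b∈p (a≢b ∘ sym))
  ∣p-a∣<∣p∣ : ∣ p - a ∣ < ∣ p ∣
  ∣p-a∣<∣p∣ = x∈p⇒∣p-x∣<∣p∣ a∈p

SameEdge : (i j a b : Fin n) → Set
SameEdge i j a b = (i ≡ a × j ≡ b) ⊎ (i ≡ b × j ≡ a)

SameEdge? : (i j a b : Fin n) → Dec (SameEdge i j a b)
SameEdge? i j a b = (i ≟ a ×-dec j ≟ b) ⊎-dec (i ≟ b ×-dec j ≟ a)

sameEdge⇒SameEdge : {i j a b : Fin n} → sameEdge i j a b ≡ true → SameEdge i j a b
sameEdge⇒SameEdge {i = i} {j} {a} {b} e with ∨-true (i == a ∧ j == b) _ e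
... | inj₁ e₁ = inj₁ (==⇒≡ (∧-conicalˡ _ _ e₁) , ==⇒≡ (∧-conicalʳ _ _ e₁))
... | inj₂ e₂ = inj₂ (==⇒≡ (∧-conicalˡ _ _ e₂) , ==⇒≡ (∧-conicalʳ _ _ e₂))

SameEdge⇒sameEdge : {i j a b : Fin n} → SameEdge i j a b → sameEdge i j a b ≡ true
SameEdge⇒sameEdge {i = i} {j} (inj₁ (refl , refl)) rewrite ≡⇒== {i = i} refl | ≡⇒== {i = j} refl = refl
SameEdge⇒sameEdge {i = i} {j} (inj₂ (refl , refl)) rewrite ≡⇒== {i = i} refl | ≡⇒== {i = j} refl =
  ∨-zeroʳ (i == j ∧ j == i)

SameEdge-sym : {i j a b : Fin n} → SameEdge i j a b → SameEdge a b i j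
SameEdge-sym (inj₁ (refl , refl)) = inj₁ (refl , refl)
SameEdge-sym (inj₂ (refl , refl)) = inj₂ (refl , refl)

removeEdge⁺ : (G : Graph n) {a b i j : Fin n} →
  adj G i j ≡ true → ¬ SameEdge i j a b → adj (removeEdge G a b) i j ≡ true
removeEdge⁺ G {a} {b} {i} {j} e ¬ij≐ab with sameEdge i j a b in eq
... | true  = contradiction (sameEdge⇒SameEdge eq) ¬ij≐ab
... | false rewrite e = refl

removeEdge⁻ : (G : Graph n) {a b i j : Fin n} →
  adj (removeEdge G a b) i j ≡ true → adj G i j ≡ true × ¬ SameEdge i j a b
removeEdge⁻ G {a} {b} {i} {j} e = ∧-conicalˡ _ _ e , ¬ij≐ab
  where
  ¬ij≐ab : ¬ SameEdge i j a b
  ¬ij≐ab ij≐ab with () ← trans (cong not (sym (SameEdge⇒sameEdge ij≐ab))) (∧-conicalʳ (adj G i j) _ e)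

degree≡∣neighbourhood∣ : (G : Graph n) (z : Fin n) → degree G z ≡ ∣ Vec.tabulate (adj G z) ∣
degree≡∣neighbourhood∣ {n} G z = trans (cong sum (map-tabulate id indicator)) (count (adj G z))
  where
  indicator : Fin n → ℕ
  indicator w = if adj G z w then 1 else 0
  count : ∀ {m} (f : Fin m → Bool) → sum (List.tabulate (λ w → if f w then 1 else 0)) ≡ ∣ Vec.tabulate f ∣
  count {zero}  f = refl
  count {suc m} f with f zero
  ... | true  = cong suc (count (f ∘ suc))
  ... | false = count (f ∘ suc)

degree-2⇒neighbours : (G : Graph n) {z p q : Fin n} → degree G z ≡ 2 →
  adj G z p ≡ true → adj G z q ≡ true → p ≢ q →
  ∀ w → adj G z w ≡ true → w ≡ p ⊎ w ≡ q
degree-2⇒neighbours G {z} {p} {q} deg zp zq p≢q w zw with w ≟ p | w ≟ q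
... | yes w≡p | _       = inj₁ w≡p
... | no _    | yes w≡q = inj₂ w≡q
... | no w≢p  | no w≢q  = contradiction 3≤2 λ { (s≤s (s≤s ())) }
  where
  3≤2 : 3 ≤ 2
  3≤2 = subst (3 ≤_) (trans (sym (degree≡∣neighbourhood∣ G z)) deg)
    (3≤∣p∣ (∈-tabulate⁺ zp) (∈-tabulate⁺ zq) (∈-tabulate⁺ zw) p≢q (w≢p ∘ sym) (w≢q ∘ sym))

VertexCover? : (G : Graph n) (S : Subset n) → Dec (VertexCover G S)
VertexCover? G S =
  all? (λ i → i ∈? S →-dec vert G i ≟ᵇ true) ×-dec
  all? (λ i → all? λ j → adj G i j ≟ᵇ true →-dec (i ∈? S ⊎-dec j ∈? S))

minVC-below : (G : Graph n) (m : ℕ) (S : Subset n) → VertexCover G S → ∣ S ∣ ≤ m →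
  Σ ℕ (IsMinVCSize G)
minVC-below G m S cov bound with anySubset? (λ T → VertexCover? G T ×-dec ∣ T ∣ <? ∣ S ∣)
minVC-below G m S cov bound | no none =
  ∣ S ∣ , (S , cov , refl) , λ T covT → ≮⇒≥ λ smaller → none (T , covT , smaller)
minVC-below G zero S cov bound | yes (T , _ , smaller) = contradiction (≤-trans smaller bound) λ ()
minVC-below G (suc m) S cov bound | yes (T , covT , smaller) =
  minVC-below G m T covT (≤-pred (≤-trans smaller bound))

minVC-exists : (G : Graph n) → (∀ i j → adj G i j ≡ true → vert G i ≡ true) → Σ ℕ (IsMinVCSize G)
minVC-exists G closed = minVC-below G _ V V-covers ≤-refl
  where
  V = Vec.tabulate (vert G)
  V-covers : VertexCover G V
  V-covers = (λ i → ∈-tabulate⁻) , λ i j e → inj₁ (∈-tabulate⁺ (closed i j e))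

EdgeCritical : Graph n → Set
EdgeCritical G = ∀ a b → adj G a b ≡ true →
  ∀ k k′ → IsMinVCSize G k → IsMinVCSize (removeEdge G a b) k′ → k′ < k

minVC-unique : {G : Graph n} {k l : ℕ} → IsMinVCSize G k → IsMinVCSize G l → k ≡ l
minVC-unique ((S , covS , refl) , minS) ((T , covT , refl) , minT) = ≤-antisym (minS T covT) (minT S covS)

module Reduction {n} (G : Graph n) (simple : Simple G) (x y u v : Fin n)
  (xy : adj G x y ≡ true) (xu : adj G x u ≡ true) (yv : adj G y v ≡ true)
  (u≢y : u ≢ y) (v≢x : v ≢ x)
  (N[x] : ∀ w → adj G x w ≡ true → w ≡ y ⊎ w ≡ u)
  (N[y] : ∀ w → adj G y w ≡ true → w ≡ x ⊎ w ≡ v)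
  where

  open Simple simple

  H : Graph n
  H = reduce G x y u v

  adj⇒≢ : {i j : Fin n} → adj G i j ≡ true → i ≢ j
  adj⇒≢ {i} e refl with () ← trans (sym e) (loopless i)

  Kept : Fin n → Set
  Kept i = i ≢ x × i ≢ y

  kept? : (i : Fin n) → Kept i ⊎ (i ≡ x ⊎ i ≡ y)
  kept? i with i ≟ x | i ≟ y
  ... | yes i≡x | _       = inj₂ (inj₁ i≡x)
  ... | no _    | yes i≡y = inj₂ (inj₂ i≡y)
  ... | no i≢x  | no i≢y  = inj₁ (i≢x , i≢y)

  x≢y : x ≢ y
  x≢y = adj⇒≢ xy

  kept-u : Kept u
  kept-u = (λ u≡x → adj⇒≢ xu (sym u≡x)) , u≢y

  kept-v : Kept v
  kept-v = v≢x , λ v≡y → adj⇒≢ yv (sym v≡y)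

  vertH⁺ : {i : Fin n} → vert G i ≡ true → Kept i → vert H i ≡ true
  vertH⁺ g (i≢x , i≢y) rewrite g | ≢⇒== i≢x | ≢⇒== i≢y = refl

  vertH⁻ : {i : Fin n} → vert H i ≡ true → vert G i ≡ true × Kept i
  vertH⁻ e = ∧-conicalˡ _ _ e , not-==⇒≢ (proj₁ kept) , not-==⇒≢ (proj₂ kept)
    where kept = not-∨ _ _ (∧-conicalʳ _ _ e)

  adjH⁺ : {i j : Fin n} → adj G i j ≡ true → Kept i → Kept j → adj H i j ≡ true
  adjH⁺ e (i≢x , i≢y) (j≢x , j≢y) rewrite e | ≢⇒== i≢x | ≢⇒== i≢y | ≢⇒== j≢x | ≢⇒== j≢y = refl

  adjH⁻ : {i j : Fin n} → adj H i j ≡ true →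
    (adj G i j ≡ true × Kept i × Kept j) ⊎ SameEdge i j u v
  adjH⁻ e with ∨-true _ _ e
  ... | inj₂ uv = inj₂ (sameEdge⇒SameEdge uv)
  ... | inj₁ old with not-∨ _ _ (∧-conicalʳ _ _ old)
  ...   | i≢x , rest with not-∨ _ _ rest
  ...     | i≢y , rest′ with not-∨ _ _ rest′
  ...       | j≢x , j≢y =
    inj₁ (∧-conicalˡ _ _ old , (not-==⇒≢ i≢x , not-==⇒≢ i≢y) , (not-==⇒≢ j≢x , not-==⇒≢ j≢y))

  adjH-new : {i j : Fin n} → SameEdge i j u v → adj H i j ≡ true
  adjH-new {i} {j} ij≐uv rewrite SameEdge⇒sameEdge ij≐uv = ∨-zeroʳ _

  adjH-uv : adj H u v ≡ true
  adjH-uv = adjH-new (inj₁ (refl , refl))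

  adjH-vu : adj H v u ≡ true
  adjH-vu = adjH-new (inj₂ (refl , refl))

  adj-sym : {i j : Fin n} → adj G i j ≡ true → adj G j i ≡ true
  adj-sym {i} {j} e = trans (symm j i) e

  edge-at-x : {S : Subset n} (j : Fin n) → x ∈ S ⊎ y ∈ S → x ∈ S ⊎ u ∈ S → adj G x j ≡ true → x ∈ S ⊎ j ∈ S
  edge-at-x j cxy cxu e with N[x] j e
  ... | inj₁ refl = cxy
  ... | inj₂ refl = cxu

  edge-at-y : {S : Subset n} (j : Fin n) → y ∈ S ⊎ x ∈ S → y ∈ S ⊎ v ∈ S → adj G y j ≡ true → y ∈ S ⊎ j ∈ S
  edge-at-y j cyx cyv e with N[y] j e
  ... | inj₁ refl = cyx
  ... | inj₂ refl = cyv

  cover-from-kept : {S : Subset n} → x ∈ S ⊎ y ∈ S → x ∈ S ⊎ u ∈ S → y ∈ S ⊎ v ∈ S →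
    (∀ i j → adj G i j ≡ true → Kept i → Kept j → i ∈ S ⊎ j ∈ S) →
    ∀ i j → adj G i j ≡ true → i ∈ S ⊎ j ∈ S
  cover-from-kept cxy cxu cyv kept i j e with i ≟ x | i ≟ y | j ≟ x | j ≟ y
  ... | yes refl | _        | _        | _        = edge-at-x j cxy cxu e
  ... | no _     | yes refl | _        | _        = edge-at-y j (swap cxy) cyv e
  ... | no _     | no _     | yes refl | _        = swap (edge-at-x i cxy cxu (adj-sym e))
  ... | no _     | no _     | no _     | yes refl = swap (edge-at-y i (swap cxy) cyv (adj-sym e))
  ... | no i≢x   | no i≢y   | no j≢x   | no j≢y   = kept i j e (i≢x , i≢y) (j≢x , j≢y)

  strip : Subset n → Subset n
  strip C = C - x - y

  strip⁺ : {C : Subset n} {i : Fin n} → i ∈ C → Kept i → i ∈ strip C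
  strip⁺ i∈C (i≢x , i≢y) = x∈p∧x≢y⇒x∈p-y (x∈p∧x≢y⇒x∈p-y i∈C i≢x) i≢y

  strip⁻ : {C : Subset n} {i : Fin n} → i ∈ strip C → i ∈ C × Kept i
  strip⁻ i∈strip with x∈p-y⇒x∈p×x≢y i∈strip
  ... | i∈C-x , i≢y with x∈p-y⇒x∈p×x≢y i∈C-x
  ...   | i∈C , i≢x = i∈C , i≢x , i≢y

  strip-smaller : (C : Subset n) → x ∈ C ⊎ y ∈ C → ∣ strip C ∣ < ∣ C ∣
  strip-smaller C = ∣p-x-y∣<∣p∣ C (x≢y ∘ sym)

  record Shrinking (C : Subset n) : Set where
    field
      shrunk    : Subset n
      smaller   : ∣ shrunk ∣ < ∣ C ∣
      shrunk⁻   : ∀ {i} → i ∈ shrunk → (i ∈ C × Kept i) ⊎ i ≡ u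
      shrunk⁺   : ∀ {i} → i ∈ C → Kept i → i ∈ shrunk
      covers-uv : u ∈ shrunk ⊎ v ∈ shrunk
  open Shrinking

  strip-shrinking : (C : Subset n) → x ∈ C ⊎ y ∈ C → u ∈ C ⊎ v ∈ C → Shrinking C
  strip-shrinking C cxy cuv = record
    { shrunk    = strip C
    ; smaller   = strip-smaller C cxy
    ; shrunk⁻   = inj₁ ∘ strip⁻
    ; shrunk⁺   = strip⁺
    ; covers-uv = Sum.map (λ u∈C → strip⁺ u∈C kept-u) (λ v∈C → strip⁺ v∈C kept-v) cuv
    }

  -- If both x and y are in C, one of the two saved slots pays for adding u.
  shrink : (C : Subset n) → x ∈ C ⊎ y ∈ C → x ∈ C ⊎ u ∈ C → y ∈ C ⊎ v ∈ C → Shrinking C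
  shrink C cxy cxu cyv with x ∈? C | y ∈? C
  ... | no x∉C  | _       = strip-shrinking C cxy (inj₁ (⊎-resolveˡ x∉C cxu))
  ... | yes _   | no y∉C  = strip-shrinking C cxy (inj₂ (⊎-resolveˡ y∉C cyv))
  ... | yes x∈C | yes y∈C = record
    { shrunk    = ⁅ u ⁆ ∪ strip C
    ; smaller   = ≤-<-trans (∣⁅x⁆∪p∣≤1+∣p∣ u (strip C)) (≤-<-trans ∣strip∣<∣C-x∣ (x∈p⇒∣p-x∣<∣p∣ x∈C))
    ; shrunk⁻   = λ i∈ → Sum.map strip⁻ (x∈⁅y⁆⇒x≡y u) (swap (x∈p∪q⁻ ⁅ u ⁆ (strip C) i∈))
    ; shrunk⁺   = λ i∈C kept → x∈p∪q⁺ (inj₂ (strip⁺ i∈C kept))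
    ; covers-uv = inj₁ (x∈p∪q⁺ (inj₁ (x∈⁅x⁆ u)))
    }
    where
    ∣strip∣<∣C-x∣ : ∣ strip C ∣ < ∣ C - x ∣
    ∣strip∣<∣C-x∣ = x∈p⇒∣p-x∣<∣p∣ (x∈p∧x≢y⇒x∈p-y y∈C (x≢y ∘ sym))

  shrunk-vertices : {C : Subset n} → (∀ i → i ∈ C → vert G i ≡ true) →
    (S : Shrinking C) → ∀ i → i ∈ shrunk S → vert H i ≡ true
  shrunk-vertices vC S i i∈ with shrunk⁻ S i∈
  ... | inj₁ (i∈C , kept) = vertH⁺ (vC i i∈C) kept
  ... | inj₂ refl         = vertH⁺ (closed u x (adj-sym xu)) kept-u

  shrunk-covers : {C : Subset n} (S : Shrinking C) {i j : Fin n} → adj H i j ≡ true →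
    (adj G i j ≡ true → i ∈ C ⊎ j ∈ C) → i ∈ shrunk S ⊎ j ∈ shrunk S
  shrunk-covers S e covered with adjH⁻ e
  ... | inj₁ (eG , ki , kj)       = Sum.map (λ i∈C → shrunk⁺ S i∈C ki) (λ j∈C → shrunk⁺ S j∈C kj) (covered eG)
  ... | inj₂ (inj₁ (refl , refl)) = covers-uv S
  ... | inj₂ (inj₂ (refl , refl)) = swap (covers-uv S)

  module _ {D : Subset n} (covD : VertexCover H D) where

    new : ∀ w → w ∈ ⁅ w ⁆ ∪ D
    new w = x∈p∪q⁺ (inj₁ (x∈⁅x⁆ w))

    old : ∀ {w i} → i ∈ D → i ∈ ⁅ w ⁆ ∪ D
    old i∈D = x∈p∪q⁺ (inj₂ i∈D)

    extend : (w : Fin n) → vert G w ≡ true → let D′ = ⁅ w ⁆ ∪ D in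
      x ∈ D′ ⊎ y ∈ D′ → x ∈ D′ ⊎ u ∈ D′ → y ∈ D′ ⊎ v ∈ D′ → VertexCover G D′
    extend w g cxy cxu cyv = vertices , cover-from-kept cxy cxu cyv kept-edges
      where
      vertices : ∀ i → i ∈ ⁅ w ⁆ ∪ D → vert G i ≡ true
      vertices i i∈ with x∈p∪q⁻ ⁅ w ⁆ D i∈
      ... | inj₁ i∈⁅w⁆ rewrite x∈⁅y⁆⇒x≡y w i∈⁅w⁆ = g
      ... | inj₂ i∈D = proj₁ (vertH⁻ (proj₁ covD i i∈D))
      kept-edges : ∀ i j → adj G i j ≡ true → Kept i → Kept j → i ∈ ⁅ w ⁆ ∪ D ⊎ j ∈ ⁅ w ⁆ ∪ D
      kept-edges i j e ki kj = Sum.map old old (proj₂ covD i j (adjH⁺ e ki kj))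

    lift : Σ (Subset n) λ D′ → VertexCover G D′ × ∣ D′ ∣ ≤ suc ∣ D ∣
    lift with proj₂ covD u v adjH-uv
    ... | inj₁ u∈D = ⁅ y ⁆ ∪ D ,
      extend y (closed y x (adj-sym xy)) (inj₂ (new y)) (inj₂ (old u∈D)) (inj₁ (new y)) ,
      ∣⁅x⁆∪p∣≤1+∣p∣ y D
    ... | inj₂ v∈D = ⁅ x ⁆ ∪ D ,
      extend x (closed x y xy) (inj₁ (new x)) (inj₁ (new x)) (inj₂ (old v∈D)) ,
      ∣⁅x⁆∪p∣≤1+∣p∣ x D

  minVC-reduce : {k : ℕ} → IsMinVCSize H k → IsMinVCSize G (suc k)
  minVC-reduce ((D , covD , refl) , minH) with lift covD
  ... | D′ , covD′ , ∣D′∣≤ = (D′ , covD′ , ≤-antisym ∣D′∣≤ (lower D′ covD′)) , lower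
    where
    lower : ∀ C → VertexCover G C → suc ∣ D ∣ ≤ ∣ C ∣
    lower C (vC , cC) = ≤-<-trans (minH (shrunk S) covS) (smaller S)
      where
      S = shrink C (cC x y xy) (cC x u xu) (cC y v yv)
      covS : VertexCover H (shrunk S)
      covS = shrunk-vertices vC S , λ i j e → shrunk-covers S e (cC i j)

  SameEdge-trans : {i j a b : Fin n} → SameEdge i j u v → SameEdge a b u v → SameEdge i j a b
  SameEdge-trans (inj₁ (refl , refl)) (inj₁ (refl , refl)) = inj₁ (refl , refl)
  SameEdge-trans (inj₁ (refl , refl)) (inj₂ (refl , refl)) = inj₂ (refl , refl)
  SameEdge-trans (inj₂ (refl , refl)) (inj₁ (refl , refl)) = inj₂ (refl , refl)
  SameEdge-trans (inj₂ (refl , refl)) (inj₂ (refl , refl)) = inj₁ (refl , refl)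

  ¬SameEdge-kept : {i j a b : Fin n} → Kept a → Kept b → i ≡ x ⊎ i ≡ y → ¬ SameEdge i j a b
  ¬SameEdge-kept (a≢x , a≢y) _ i∈xy (inj₁ (refl , _)) = Sum.[ a≢x , a≢y ] i∈xy
  ¬SameEdge-kept _ (b≢x , b≢y) i∈xy (inj₂ (refl , _)) = Sum.[ b≢x , b≢y ] i∈xy

  Shrinks : Graph n → Graph n → Set
  Shrinks K K′ = ∀ C → VertexCover K C → Σ (Subset n) λ C′ → VertexCover K′ C′ × ∣ C′ ∣ < ∣ C ∣

  deleting-new-edge : {a b : Fin n} → SameEdge a b u v → Shrinks (removeEdge G x u) (removeEdge H a b)
  deleting-new-edge ab≐uv C (vC , cC) = strip C , (vertices , edges) , strip-smaller C (cC x y xy′)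
    where
    xy′ : adj (removeEdge G x u) x y ≡ true
    xy′ = removeEdge⁺ G xy λ { (inj₁ (_ , y≡u)) → u≢y (sym y≡u) ; (inj₂ (x≡u , _)) → adj⇒≢ xu x≡u }
    vertices : ∀ i → i ∈ strip C → vert H i ≡ true
    vertices i i∈ = let i∈C , kept = strip⁻ i∈ in vertH⁺ (vC i i∈C) kept
    edges : ∀ i j → adj (removeEdge H _ _) i j ≡ true → i ∈ strip C ⊎ j ∈ strip C
    edges i j e with removeEdge⁻ H e
    ... | eH , ¬ij≐ab with adjH⁻ eH
    ...   | inj₂ ij≐uv = contradiction (SameEdge-trans ij≐uv ab≐uv) ¬ij≐ab
    ...   | inj₁ (eG , ki , kj) =
      Sum.map (λ i∈C → strip⁺ i∈C ki) (λ j∈C → strip⁺ j∈C kj)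
        (cC i j (removeEdge⁺ G eG (¬SameEdge-kept ki kj (inj₁ refl) ∘ SameEdge-sym)))

  deleting-old-edge : {a b : Fin n} → Kept a → Kept b → Shrinks (removeEdge G a b) (removeEdge H a b)
  deleting-old-edge {a} {b} ka kb C (vC , cC) = shrunk S , (shrunk-vertices vC S , edges) , smaller S
    where
    keep : ∀ {i j} → i ≡ x ⊎ i ≡ y → adj G i j ≡ true → i ∈ C ⊎ j ∈ C
    keep i∈xy e = cC _ _ (removeEdge⁺ G e (¬SameEdge-kept ka kb i∈xy))
    S = shrink C (keep (inj₁ refl) xy) (keep (inj₁ refl) xu) (keep (inj₂ refl) yv)
    edges : ∀ i j → adj (removeEdge H a b) i j ≡ true → i ∈ shrunk S ⊎ j ∈ shrunk S
    edges i j e with removeEdge⁻ H e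
    ... | eH , ¬ij≐ab = shrunk-covers S eH λ eG → cC i j (removeEdge⁺ G eG ¬ij≐ab)

  deleting-edge : {a b : Fin n} → adj H a b ≡ true →
    Σ (Fin n) λ p → Σ (Fin n) λ q → adj G p q ≡ true × Shrinks (removeEdge G p q) (removeEdge H a b)
  deleting-edge {a} {b} ab with SameEdge? a b u v
  ... | yes ab≐uv = x , u , xu , deleting-new-edge ab≐uv
  ... | no ¬ab≐uv with adjH⁻ ab
  ...   | inj₁ (abG , ka , kb) = a , b , abG , deleting-old-edge ka kb
  ...   | inj₂ ab≐uv           = contradiction ab≐uv ¬ab≐uv

  critical-H : EdgeCritical G → EdgeCritical H
  critical-H critical-G a b ab k k′ minH minH′ with deleting-edge ab
  ... | p , q , pq , shrinks with minVC-exists (removeEdge G p q) (λ i j e → closed i j (proj₁ (removeEdge⁻ G e)))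
  ... | m , minG′@((C , covC , refl) , _) with shrinks C covC
  ... | C′ , covC′ , ∣C′∣<∣C∣ =
    <-≤-trans (≤-<-trans (proj₂ minH′ C′ covC′) ∣C′∣<∣C∣)
                (≤-pred (critical-G p q pq (suc k) ∣ C ∣ (minVC-reduce minH) minG′))

  shadow : Fin n → Fin n
  shadow i with i ≟ x | i ≟ y
  ... | yes _ | _     = u
  ... | no _  | yes _ = v
  ... | no _  | no _  = i

  shadow-x : shadow x ≡ u
  shadow-x with x ≟ x
  ... | yes _  = refl
  ... | no x≢x = contradiction refl x≢x

  shadow-y : shadow y ≡ v
  shadow-y with y ≟ x | y ≟ y
  ... | yes y≡x | _      = contradiction (sym y≡x) x≢y
  ... | no _    | yes _  = refl
  ... | no _    | no y≢y = contradiction refl y≢y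

  shadow-kept : {i : Fin n} → Kept i → shadow i ≡ i
  shadow-kept {i} (i≢x , i≢y) with i ≟ x | i ≟ y
  ... | yes i≡x | _       = contradiction i≡x i≢x
  ... | no _    | yes i≡y = contradiction i≡y i≢y
  ... | no _    | no _    = refl

  ShadowStep : Fin n → Fin n → Set
  ShadowStep c d = shadow c ≡ shadow d ⊎ adj H (shadow c) (shadow d) ≡ true

  shadow-step-x : {d : Fin n} → adj G x d ≡ true → ShadowStep x d
  shadow-step-x e with N[x] _ e
  ... | inj₁ refl rewrite shadow-x | shadow-y = inj₂ adjH-uv
  ... | inj₂ refl rewrite shadow-x | shadow-kept kept-u = inj₁ refl

  shadow-step-y : {d : Fin n} → adj G y d ≡ true → ShadowStep y d
  shadow-step-y e with N[y] _ e
  ... | inj₁ refl rewrite shadow-y | shadow-x = inj₂ adjH-vu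
  ... | inj₂ refl rewrite shadow-y | shadow-kept kept-v = inj₁ refl

  -- A kept neighbour of x must be u, which is also the shadow of x; likewise for y and v.
  shadow-step-kept : {c d : Fin n} → Kept c → adj G c d ≡ true → ShadowStep c d
  shadow-step-kept {c} {d} kc e with kept? d
  ... | inj₁ kd rewrite shadow-kept kc | shadow-kept kd = inj₂ (adjH⁺ e kc kd)
  ... | inj₂ (inj₁ refl) =
    inj₁ (trans (shadow-kept kc) (trans (⊎-resolveˡ (proj₂ kc) (N[x] c (adj-sym e))) (sym shadow-x)))
  ... | inj₂ (inj₂ refl) =
    inj₁ (trans (shadow-kept kc) (trans (⊎-resolveˡ (proj₁ kc) (N[y] c (adj-sym e))) (sym shadow-y)))

  shadow-step : {c d : Fin n} → adj G c d ≡ true → ShadowStep c d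
  shadow-step {c} e with kept? c
  ... | inj₁ kc          = shadow-step-kept kc e
  ... | inj₂ (inj₁ refl) = shadow-step-x e
  ... | inj₂ (inj₂ refl) = shadow-step-y e

  walk-shadow : {c b : Fin n} → Walk G c b → Walk H (shadow c) (shadow b)
  walk-shadow here = here
  walk-shadow (step e w) with shadow-step e
  ... | inj₁ same = subst (λ t → Walk H t _) (sym same) (walk-shadow w)
  ... | inj₂ e′   = step e′ (walk-shadow w)

  connected-H : Connected G → Connected H
  connected-H connected-G a b a∈H b∈H with vertH⁻ a∈H | vertH⁻ b∈H
  ... | a∈G , ka | b∈G , kb =
    subst₂ (Walk H) (shadow-kept ka) (shadow-kept kb) (walk-shadow (connected-G a b a∈G b∈G))

theorem13 : ∀ {n} (G : Graph n) → Simple G → VCIrreducible G →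
    (x y u v : Fin n) →
    adj G x y ≡ true → degree G x ≡ 2 → degree G y ≡ 2 →
    adj G x u ≡ true → ¬ (u ≡ y) →
    adj G y v ≡ true → ¬ (v ≡ x) →
    VCIrreducible (reduce G x y u v) ×
    (∀ k k' → IsMinVCSize G k → IsMinVCSize (reduce G x y u v) k' → k ≡ suc k')
theorem13 G simple (connected-G , critical-G) x y u v xy deg-x deg-y xu u≢y yv v≢x =
  (connected-H connected-G , critical-H critical-G) ,
  λ k k′ minG minH → minVC-unique minG (minVC-reduce minH)
  where
  yx : adj G y x ≡ true
  yx = trans (Simple.symm simple y x) xy
  open Reduction G simple x y u v xy xu yv u≢y v≢x
    (degree-2⇒neighbours G deg-x xy xu (u≢y ∘ sym))
    (degree-2⇒neighbours G deg-y yx yv (v≢x ∘ sym))
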